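{- Let $L\subseteq\mathbb{C}^n$ be a linear subspace, let $m\ge1$, and let $S,T\subseteq[m]\times[n]$ be such that for every $j\in[n]$ the sets $S_{*,j}$ and $T_{*,j}$ have the same cardinality. Then \[\prod_{i=1}^mz_{S_{i,*}}-\prod_{i=1}^mz_{T_{i,*}}\in I_L^{\mathrm{SE}}.\]
   Context: For $S\subseteq[m]\times[n]$ (viewed as an $m\times n$ $0/1$ matrix), $S_{i,*}=\{j\in[n]:(i,j)\in S\}$ and $S_{*,j}=\{i\in[m]:(i,j)\in S\}$. Let $M$ be the matroid of $L$ on $[n]$ (circuits are minimal nonempty supports of linear forms vanishing on $L$); for each circuit $C$ fix coefficients $\alpha_{C,i}$ of a nonzero linear form $\sum_{i\in C}\alpha_{C,i}x_i$ vanishing on $L$. For $A\subseteq[n]\setminus C$, $f_C^A(z)=\sum_{i\in C}\alpha_{C,i}z_{A\cup\{i\}}$. $I_L^{\mathrm{SE}}\subseteq\mathbb{C}[z_S:S\subseteq[n]]$ is generated by all $z_Sz_T-z_{S\cup T}z_{S\cap T}$ ($S,T\subseteq[n]$) and all $f_C^A(z)$. -}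

module Defs where

open import Level using (Level; _⊔_) renaming (suc to lsuc)
open import Data.Nat using (ℕ; zero; suc)
open import Data.Fin using (Fin; zero; suc)
open import Data.Fin.Subset using (Subset; _∪_; _∩_; _∈_; _∉_; ⁅_⁆; ∣_∣)
open import Data.Vec using (lookup; tabulate)
open import Data.Bool using (if_then_else_)
open import Data.Product using (Σ; ∃; _×_)
open import Relation.Nullary using (¬_)
open import Algebra.Bundles using (CommutativeRing)

record Field (c ℓ : Level) : Set (lsuc (c ⊔ ℓ)) where
  field
    commutativeRing : CommutativeRing c ℓ
  open CommutativeRing commutativeRing public
  field
    0≉1 : ¬ (0# ≈ 1#)
    inverse : ∀ x → ¬ (x ≈ 0#) → ∃ λ y → (x * y) ≈ 1#

module _ {c ℓ : Level} (F : Field c ℓ) where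
  open Field F using (_≈_; _+_; _*_; -_; 0#; 1#) renaming (Carrier to K)

  ΣK : ∀ {k} → (Fin k → K) → K
  ΣK {zero} f = 0#
  ΣK {suc k} f = f zero + ΣK (λ i → f (suc i))

  record Subspace (n : ℕ) (p : Level) : Set (c ⊔ ℓ ⊔ lsuc p) where
    field
      member : (Fin n → K) → Set p
      member-resp : ∀ {v w} → (∀ i → v i ≈ w i) → member v → member w
      member-0 : member (λ _ → 0#)
      member-+ : ∀ {v w} → member v → member w → member (λ i → v i + w i)
      member-* : ∀ a {v} → member v → member (λ i → a * v i)

  module _ {n : ℕ} {p : Level} (L : Subspace n p) where
    open Subspace L

    VanishesOn : (Fin n → K) → Set (c ⊔ ℓ ⊔ p)
    VanishesOn α = ∀ v → member v → ΣK (λ i → α i * v i) ≈ 0#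

    SupportIs : (Fin n → K) → Subset n → Set ℓ
    SupportIs α C = ∀ i → (i ∈ C → ¬ (α i ≈ 0#)) × (¬ (α i ≈ 0#) → i ∈ C)

    -- C is a circuit of the matroid of L: a minimal nonempty support of a
    -- linear form vanishing on L.
    IsCircuit : Subset n → Set (c ⊔ ℓ ⊔ p)
    IsCircuit C =
      (Σ (Fin n → K) λ α → VanishesOn α × SupportIs α C)
      × (Σ (Fin n) λ i → i ∈ C)
      × (∀ β D → VanishesOn β → SupportIs β D → (Σ (Fin n) λ i → i ∈ D)
           → (∀ i → i ∈ D → i ∈ C) → ∀ i → i ∈ C → i ∈ D)

    record CircuitChoice : Set (c ⊔ ℓ ⊔ p) where
      field
        coeff : (C : Subset n) → IsCircuit C → Fin n → K
        coeff-vanishes : ∀ C (h : IsCircuit C) → VanishesOn (coeff C h)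
        coeff-support : ∀ C (h : IsCircuit C) → SupportIs (coeff C h) C

  data Poly (n : ℕ) : Set c where
    var : Subset n → Poly n
    con : K → Poly n
    _⊕_ : Poly n → Poly n → Poly n
    _⊗_ : Poly n → Poly n → Poly n
    ⊝_ : Poly n → Poly n

  infixl 6 _⊕_
  infixl 7 _⊗_
  infix 8 ⊝_

  -- Equality in the polynomial ring K[z_S : S ⊆ [n]] (the free commutative
  -- K-algebra on the variables): the least congruence containing the
  -- commutative-ring axioms and the arithmetic of constants.
  data _≈P_ {n : ℕ} : Poly n → Poly n → Set (c ⊔ ℓ) where
    P-refl : ∀ {p} → p ≈P p
    P-sym : ∀ {p q} → p ≈P q → q ≈P p
    P-trans : ∀ {p q r} → p ≈P q → q ≈P r → p ≈P r
    ⊕-cong : ∀ {p p' q q'} → p ≈P p' → q ≈P q' → (p ⊕ q) ≈P (p' ⊕ q')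
    ⊗-cong : ∀ {p p' q q'} → p ≈P p' → q ≈P q' → (p ⊗ q) ≈P (p' ⊗ q')
    ⊝-cong : ∀ {p p'} → p ≈P p' → (⊝ p) ≈P (⊝ p')
    ⊕-assoc : ∀ p q r → ((p ⊕ q) ⊕ r) ≈P (p ⊕ (q ⊕ r))
    ⊕-comm : ∀ p q → (p ⊕ q) ≈P (q ⊕ p)
    ⊕-identity : ∀ p → (con 0# ⊕ p) ≈P p
    ⊕-inverse : ∀ p → ((⊝ p) ⊕ p) ≈P con 0#
    ⊗-assoc : ∀ p q r → ((p ⊗ q) ⊗ r) ≈P (p ⊗ (q ⊗ r))
    ⊗-comm : ∀ p q → (p ⊗ q) ≈P (q ⊗ p)
    ⊗-identity : ∀ p → (con 1# ⊗ p) ≈P p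
    distrib : ∀ p q r → (p ⊗ (q ⊕ r)) ≈P ((p ⊗ q) ⊕ (p ⊗ r))
    con-cong : ∀ {a b} → a ≈ b → con a ≈P con b
    con-+ : ∀ a b → con (a + b) ≈P (con a ⊕ con b)
    con-* : ∀ a b → con (a * b) ≈P (con a ⊗ con b)
    con-- : ∀ a → con (- a) ≈P (⊝ con a)

  data ⟨_⟩ {n : ℕ} {q : Level} (G : Poly n → Set q) : Poly n → Set (c ⊔ ℓ ⊔ q) where
    gen : ∀ {g} → G g → ⟨ G ⟩ g
    zero∈ : ⟨ G ⟩ (con 0#)
    add∈ : ∀ {f g} → ⟨ G ⟩ f → ⟨ G ⟩ g → ⟨ G ⟩ (f ⊕ g)
    mul∈ : ∀ r {f} → ⟨ G ⟩ f → ⟨ G ⟩ (r ⊗ f)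
    resp∈ : ∀ {f g} → f ≈P g → ⟨ G ⟩ f → ⟨ G ⟩ g

  ΣP : ∀ {n k} → (Fin k → Poly n) → Poly n
  ΣP {k = zero} f = con 0#
  ΣP {k = suc k} f = f zero ⊕ ΣP (λ i → f (suc i))

  ΠP : ∀ {n k} → (Fin k → Poly n) → Poly n
  ΠP {k = zero} f = con 1#
  ΠP {k = suc k} f = f zero ⊗ ΠP (λ i → f (suc i))

  module _ {n : ℕ} {p : Level} (L : Subspace n p) (χ : CircuitChoice L) where
    open CircuitChoice χ

    fCA : (C : Subset n) → IsCircuit L C → Subset n → Poly n
    fCA C h A = ΣP (λ i → if lookup C i then con (coeff C h i) ⊗ var (A ∪ ⁅ i ⁆) else con 0#)

    data SEGen : Poly n → Set (c ⊔ ℓ ⊔ p) where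
      binom : ∀ S T → SEGen (var S ⊗ var T ⊕ ⊝ (var (S ∪ T) ⊗ var (S ∩ T)))
      circ : ∀ C (h : IsCircuit L C) A → (∀ i → i ∈ A → i ∉ C) → SEGen (fCA C h A)

    I-SE : Poly n → Set (c ⊔ ℓ ⊔ p)
    I-SE = ⟨ SEGen ⟩

-- a subset S ⊆ [m] × [n] given by its rows S_{i,*} ⊆ [n]; the column S_{*,j} ⊆ [m]
column : ∀ {m n} → (Fin m → Subset n) → Fin n → Subset m
column S j = tabulate (λ i → lookup (S i) j)

{-# OPTIONS --safe #-}
-- Modulo the binomials z_S z_T − z_{S∪T} z_{S∩T} every monomial z_{A₁} ⋯ z_{A_m} can be
-- sorted into the chain z_{U₁} ⋯ z_{U_m} with U_k = {j : c_j ≥ k}, where c_j is the number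
-- of A_i containing j. Multiplying a sorted monomial by z_A takes one binomial,
-- z_A z_{U₁} ≡ z_{A∪U₁} z_{A∩U₁}, after which A ∩ U₁ is inserted into the shorter chain
-- z_{U₂} ⋯ z_{U_m}. The sorted monomial only depends on the column counts c, so two
-- monomials with equal column counts are congruent.
module Submission where

open import Defs
open import Level using (Level; _⊔_)
open import Function using (_∘_)
open import Data.Nat using (ℕ; zero; suc; _+_; _≤_; pred)
open import Data.Nat.Properties using (n≤0⇒n≡0; pred-mono-≤)
open import Data.Bool using (Bool; true; false; _∧_; _∨_)
open import Data.Bool.Properties using (∨-identityʳ)
open import Data.Fin using (Fin; zero; suc)
open import Data.Fin.Subset using (Subset; ∣_∣; _∪_; _∩_)
open import Data.Fin.Subset.Properties using (∣p∣≤n)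
open import Data.Vec using (Vec; _∷_; lookup; tabulate)
open import Data.Vec.Properties using (tabulate-cong; tabulate∘lookup; lookup∘tabulate; lookup-zipWith)
open import Relation.Binary using (Rel; Setoid; IsEquivalence; IsPreorder; Preorder)
open import Relation.Binary.PropositionalEquality as ≡ using (_≡_; refl)
open import Algebra.Bundles using (CommutativeRing)
import Algebra.Consequences.Setoid as Consequences
import Algebra.Properties.Ring as RingProperties
import Algebra.Properties.AbelianGroup as AbelianGroupProperties
import Algebra.Properties.Group as GroupProperties
import Relation.Binary.Reasoning.Preorder as PreorderReasoning
import Relation.Binary.Reasoning.Setoid as SetoidReasoning

[_] : Bool → ℕ
[ true ] = 1
[ false ] = 0

nonZeroᵇ : ℕ → Bool
nonZeroᵇ zero = false
nonZeroᵇ (suc _) = true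

nonZeroᵇ-[]+ : ∀ b x → nonZeroᵇ ([ b ] + x) ≡ b ∨ nonZeroᵇ x
nonZeroᵇ-[]+ true x = refl
nonZeroᵇ-[]+ false x = refl

[∧nonZeroᵇ]+pred : ∀ b x → [ b ∧ nonZeroᵇ x ] + pred x ≡ pred ([ b ] + x)
[∧nonZeroᵇ]+pred true zero = refl
[∧nonZeroᵇ]+pred true (suc x) = refl
[∧nonZeroᵇ]+pred false x = refl

∣∷∣ : ∀ {k} b (v : Vec Bool k) → ∣ b ∷ v ∣ ≡ [ b ] + ∣ v ∣
∣∷∣ true v = refl
∣∷∣ false v = refl

lookup-ext : ∀ {a} {A : Set a} {k} {u v : Vec A k} → (∀ j → lookup u j ≡ lookup v j) → u ≡ v
lookup-ext {u = u} {v} u≗v =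
  ≡.trans (≡.sym (tabulate∘lookup u)) (≡.trans (tabulate-cong u≗v) (tabulate∘lookup v))

module _ {n : ℕ} where

  support : (Fin n → ℕ) → Subset n
  support c = tabulate (nonZeroᵇ ∘ c)

  support-cong : ∀ {c d : Fin n → ℕ} → (∀ j → c j ≡ d j) → support c ≡ support d
  support-cong c≗d = tabulate-cong (≡.cong nonZeroᵇ ∘ c≗d)

  lookup-∪-support : ∀ A c j → lookup (A ∪ support c) j ≡ lookup A j ∨ nonZeroᵇ (c j)
  lookup-∪-support A c j =
    ≡.trans (lookup-zipWith _∨_ j A (support c)) (≡.cong (lookup A j ∨_) (lookup∘tabulate _ j))

  lookup-∩-support : ∀ A c j → lookup (A ∩ support c) j ≡ lookup A j ∧ nonZeroᵇ (c j)
  lookup-∩-support A c j =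
    ≡.trans (lookup-zipWith _∧_ j A (support c)) (≡.cong (lookup A j ∧_) (lookup∘tabulate _ j))

  addRow : Subset n → (Fin n → ℕ) → Fin n → ℕ
  addRow A c j = [ lookup A j ] + c j

  support-addRow : ∀ A c → support (addRow A c) ≡ A ∪ support c
  support-addRow A c = lookup-ext λ j → begin
    lookup (support (addRow A c)) j  ≡⟨ lookup∘tabulate _ j ⟩
    nonZeroᵇ ([ lookup A j ] + c j)  ≡⟨ nonZeroᵇ-[]+ (lookup A j) (c j) ⟩
    lookup A j ∨ nonZeroᵇ (c j)      ≡⟨ lookup-∪-support A c j ⟨
    lookup (A ∪ support c) j         ∎
    where open ≡.≡-Reasoning

  support-addRow-zero : ∀ A (c : Fin n → ℕ) → (∀ j → c j ≡ 0) → support (addRow A c) ≡ A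
  support-addRow-zero A c c≗0 = lookup-ext λ j → begin
    lookup (support (addRow A c)) j  ≡⟨ lookup∘tabulate _ j ⟩
    nonZeroᵇ ([ lookup A j ] + c j)  ≡⟨ ≡.cong (λ x → nonZeroᵇ ([ lookup A j ] + x)) (c≗0 j) ⟩
    nonZeroᵇ ([ lookup A j ] + 0)    ≡⟨ nonZeroᵇ-[]+ (lookup A j) 0 ⟩
    lookup A j ∨ false               ≡⟨ ∨-identityʳ (lookup A j) ⟩
    lookup A j                       ∎
    where open ≡.≡-Reasoning

  addRow-∩-support-pred : ∀ A c j → addRow (A ∩ support c) (pred ∘ c) j ≡ pred (addRow A c j)
  addRow-∩-support-pred A c j =
    ≡.trans (≡.cong (λ b → [ b ] + pred (c j)) (lookup-∩-support A c j))
            ([∧nonZeroᵇ]+pred (lookup A j) (c j))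

module _ {a ℓ : Level} (F : Field a ℓ) {n : ℕ} where

  ≈P-isEquivalence : IsEquivalence (_≈P_ F {n})
  ≈P-isEquivalence = record { refl = P-refl ; sym = P-sym ; trans = P-trans }

  ≈P-setoid : Setoid a (a ⊔ ℓ)
  ≈P-setoid = record { isEquivalence = ≈P-isEquivalence }

  polyRing : CommutativeRing a (a ⊔ ℓ)
  polyRing = record
    { Carrier = Poly F n ; _≈_ = _≈P_ F ; _+_ = _⊕_ ; _*_ = _⊗_ ; -_ = ⊝_
    ; 0# = con (Field.0# F) ; 1# = con (Field.1# F)
    ; isCommutativeRing = record
      { isRing = record
        { +-isAbelianGroup = record
          { isGroup = record
            { isMonoid = record
              { isSemigroup = record
                { isMagma = record { isEquivalence = ≈P-isEquivalence ; ∙-cong = ⊕-cong }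
                ; assoc = ⊕-assoc }
              ; identity = comm∧idˡ⇒id ⊕-comm ⊕-identity }
            ; inverse = comm∧invˡ⇒inv ⊕-comm ⊕-inverse
            ; ⁻¹-cong = ⊝-cong }
          ; comm = ⊕-comm }
        ; *-cong = ⊗-cong
        ; *-assoc = ⊗-assoc
        ; *-identity = comm∧idˡ⇒id ⊗-comm ⊗-identity
        ; distrib = comm∧distrˡ⇒distr ⊕-cong ⊗-comm distrib }
      ; *-comm = ⊗-comm } }
    where open Consequences ≈P-setoid

  module CongruenceModulo {q : Level} (G : Poly F n → Set q) where
    open CommutativeRing polyRing hiding (_+_)
    open RingProperties ring using (-1*x≈-x; x[y-z]≈xy-xz)
    open AbelianGroupProperties +-abelianGroup using (⁻¹-anti-homo‿-)
    open GroupProperties +-group using (x≈y⇒x∙y⁻¹≈ε)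

    infix 4 _≋_
    _≋_ : Rel (Poly F n) (a ⊔ ℓ ⊔ q)
    f ≋ g = ⟨_⟩ F G (f - g)

    ≈⇒≋ : ∀ {f g} → f ≈ g → f ≋ g
    ≈⇒≋ f≈g = resp∈ (sym (x≈y⇒x∙y⁻¹≈ε f≈g)) zero∈

    ≋-sym : ∀ {f g} → f ≋ g → g ≋ f
    ≋-sym {f} {g} f≋g = resp∈ (trans (-1*x≈-x (f - g)) (⁻¹-anti-homo‿- f g)) (mul∈ (- 1#) f≋g)

    ≋-trans : ∀ {f g h} → f ≋ g → g ≋ h → f ≋ h
    ≋-trans {f} {g} {h} f≋g g≋h = resp∈ telescope (add∈ f≋g g≋h)
      where
      telescope : (f - g) ⊕ (g - h) ≈ f - h
      telescope = trans (+-assoc f (- g) (g - h)) (+-congˡ (begin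
        - g ⊕ (g - h)  ≈⟨ +-assoc (- g) g (- h) ⟨
        (- g ⊕ g) - h  ≈⟨ +-congʳ (-‿inverseˡ g) ⟩
        0# - h         ≈⟨ +-identityˡ (- h) ⟩
        - h            ∎))
        where open SetoidReasoning setoid

    ≋-*-congˡ : ∀ h {f g} → f ≋ g → h * f ≋ h * g
    ≋-*-congˡ h {f} {g} f≋g = resp∈ (x[y-z]≈xy-xz h f g) (mul∈ h f≋g)

    ≋-*-congʳ : ∀ h {f g} → f ≋ g → f * h ≋ g * h
    ≋-*-congʳ h {f} {g} f≋g =
      ≋-trans (≈⇒≋ (*-comm f h)) (≋-trans (≋-*-congˡ h f≋g) (≈⇒≋ (*-comm h g)))

    ≋-isPreorder : IsPreorder _≈_ _≋_
    ≋-isPreorder = record { isEquivalence = isEquivalence ; reflexive = ≈⇒≋ ; trans = ≋-trans }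

    ≋-preorder : Preorder a (a ⊔ ℓ) (a ⊔ ℓ ⊔ q)
    ≋-preorder = record { isPreorder = ≋-isPreorder }

  sortedMonomial : ℕ → (Fin n → ℕ) → Poly F n
  sortedMonomial zero c = con (Field.1# F)
  sortedMonomial (suc m) c = var (support c) ⊗ sortedMonomial m (pred ∘ c)

  sortedMonomial-cong : ∀ m {c d} → (∀ j → c j ≡ d j) → sortedMonomial m c ≡ sortedMonomial m d
  sortedMonomial-cong zero c≗d = refl
  sortedMonomial-cong (suc m) c≗d =
    ≡.cong₂ _⊗_ (≡.cong var (support-cong c≗d)) (sortedMonomial-cong m (≡.cong pred ∘ c≗d))

  columnCounts : ∀ {m} → (Fin m → Subset n) → Fin n → ℕ
  columnCounts S j = ∣ column S j ∣

  binomial : Subset n → Subset n → Poly F n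
  binomial S T = var S ⊗ var T ⊕ ⊝ (var (S ∪ T) ⊗ var (S ∩ T))

  module Sorting {q : Level} (G : Poly F n → Set q) (binomial∈ : ∀ S T → ⟨_⟩ F G (binomial S T)) where
    open CongruenceModulo G
    open PreorderReasoning ≋-preorder

    sortedMonomial-insert : ∀ m c → (∀ j → c j ≤ m) → ∀ A →
      var A ⊗ sortedMonomial m c ≋ sortedMonomial (suc m) (addRow A c)
    sortedMonomial-insert zero c c≤0 A = begin
      var A ⊗ con (Field.1# F)                       ≡⟨ ≡.cong (λ S → var S ⊗ con (Field.1# F)) support≡A ⟨
      var (support (addRow A c)) ⊗ con (Field.1# F)  ∎
      where
      support≡A : support (addRow A c) ≡ A
      support≡A = support-addRow-zero A c (n≤0⇒n≡0 ∘ c≤0)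
    sortedMonomial-insert (suc m) c c≤1+m A = begin
      var A ⊗ (var U ⊗ R)              ≈⟨ P-sym (⊗-assoc (var A) (var U) R) ⟩
      (var A ⊗ var U) ⊗ R              ≲⟨ ≋-*-congʳ R (binomial∈ A U) ⟩
      (var (A ∪ U) ⊗ var (A ∩ U)) ⊗ R  ≈⟨ ⊗-assoc (var (A ∪ U)) (var (A ∩ U)) R ⟩
      var (A ∪ U) ⊗ (var (A ∩ U) ⊗ R)  ≲⟨ ≋-*-congˡ (var (A ∪ U)) insert-A∩U ⟩
      var (A ∪ U) ⊗ sortedMonomial (suc m) (addRow (A ∩ U) (pred ∘ c))
        ≡⟨ ≡.cong₂ _⊗_ (≡.cong var (≡.sym (support-addRow A c)))
                       (sortedMonomial-cong (suc m) (addRow-∩-support-pred A c)) ⟩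
      sortedMonomial (suc (suc m)) (addRow A c)  ∎
      where
      U = support c
      R = sortedMonomial m (pred ∘ c)
      insert-A∩U : var (A ∩ U) ⊗ R ≋ sortedMonomial (suc m) (addRow (A ∩ U) (pred ∘ c))
      insert-A∩U = sortedMonomial-insert m (pred ∘ c) (pred-mono-≤ ∘ c≤1+m) (A ∩ U)

    monomial≋sortedMonomial : ∀ m (S : Fin m → Subset n) →
      ΠP F (var ∘ S) ≋ sortedMonomial m (columnCounts S)
    monomial≋sortedMonomial zero S = ≈⇒≋ P-refl
    monomial≋sortedMonomial (suc m) S = begin
      var (S zero) ⊗ ΠP F (var ∘ S ∘ suc)
        ≲⟨ ≋-*-congˡ (var (S zero)) (monomial≋sortedMonomial m (S ∘ suc)) ⟩
      var (S zero) ⊗ sortedMonomial m (columnCounts (S ∘ suc))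
        ≲⟨ sortedMonomial-insert m _ (∣p∣≤n ∘ column (S ∘ suc)) (S zero) ⟩
      sortedMonomial (suc m) (addRow (S zero) (columnCounts (S ∘ suc)))
        ≡⟨ sortedMonomial-cong (suc m) (λ j → ≡.sym (∣∷∣ (lookup (S zero) j) (column (S ∘ suc) j))) ⟩
      sortedMonomial (suc m) (columnCounts S)  ∎

    sameColumnCounts⇒≋ : ∀ m (S T : Fin m → Subset n) →
      (∀ j → columnCounts S j ≡ columnCounts T j) → ΠP F (var ∘ S) ≋ ΠP F (var ∘ T)
    sameColumnCounts⇒≋ m S T S≗T = begin
      ΠP F (var ∘ S)                     ≲⟨ monomial≋sortedMonomial m S ⟩
      sortedMonomial m (columnCounts S)  ≡⟨ sortedMonomial-cong m S≗T ⟩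
      sortedMonomial m (columnCounts T)  ≲⟨ ≋-sym (monomial≋sortedMonomial m T) ⟩
      ΠP F (var ∘ T)                     ∎

lemma5p18 : ∀ {c ℓ p : Level} (F : Field c ℓ) (n : ℕ) (L : Subspace F n p)
    (χ : CircuitChoice F L) (m : ℕ) → 1 ≤ m
    → (S T : Fin m → Subset n)
    → (∀ j → ∣ column S j ∣ ≡ ∣ column T j ∣)
    → I-SE F L χ (ΠP F (λ i → var (S i)) ⊕ ⊝ ΠP F (λ i → var (T i)))
lemma5p18 F n L χ m _ S T =
  Sorting.sameColumnCounts⇒≋ F (SEGen F L χ) (λ S T → gen (binom S T)) m S T
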